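{- For every rational number $r$ with $r\neq 0,\pm 1,\pm\frac12$, there exist infinitely many rational numbers $b$ such that $\{1,b\}$ is a strong rational Diophantine $D(r^2-1)$-pair.
   Context: Let $q$ be a rational number. A strong rational Diophantine $D(q)$-pair is a set $\{a_1,a_2\}$ of two distinct non-zero rational numbers such that $a_1^2+q$, $a_2^2+q$ and $a_1a_2+q$ are all squares of rational numbers. -}

module Defs where

open import Data.Rational using (ℚ; _*_; _+_)
open import Data.Product using (Σ; ∃; _×_)
open import Relation.Binary.PropositionalEquality using (_≡_)
open import Relation.Nullary using (¬_)

IsSquare : ℚ → Set
IsSquare x = ∃ λ (y : ℚ) → y * y ≡ x

StrongDPair : ℚ → ℚ → ℚ → Set
StrongDPair q a₁ a₂ =
  ¬ (a₁ ≡ a₂) × ¬ (a₁ ≡ Data.Rational.0ℚ) × ¬ (a₂ ≡ Data.Rational.0ℚ) ×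
  IsSquare (a₁ * a₁ + q) × IsSquare (a₂ * a₂ + q) × IsSquare (a₁ * a₂ + q)

{-# OPTIONS --safe #-}
module Submission where

-- Write r = u / v in lowest terms and C = u² - v², so that r² - 1 = C / v².  An integer
-- solution (B, S, T, W) of S² = B + C W², T² = B² + C v² W⁴ gives b = B / (v W)² with
-- b + (r² - 1) = (S / v W)² and b² + (r² - 1) = (T / (v W)²)².  These equations define a
-- curve of genus one, which has a polynomial self-map sending W to 2 S T W and keeping B and
-- T odd and v W even.  Hence b ≠ 0, 1, and the 2-adic valuation of b, namely
-- -2 v₂(v W), strictly decreases along the orbit, so the iterated doubles are pairwise
-- distinct.  A first solution is b = 5/4 - r² when v is odd or divisible by 4, and
-- b = (1 + 16 r² - 16 r⁴) / (4 r² - 1)² when v ≡ 2 (mod 4); the latter is where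
-- r ≠ ±1/2 is needed.

open import Data.Nat as ℕ using (ℕ; zero; suc)
import Data.Nat.Properties as ℕP
open import Data.Nat.GeneralisedArithmetic using (fold; fold-+)
import Data.Integer as ℤ
open ℤ using (ℤ; +_; -[1+_]; 0ℤ; 1ℤ; ∣_∣)
import Data.Integer.Properties as ℤP
open import Data.Integer.Divisibility.Signed using (_∣_; divides; ∣-trans)
open import Data.List using (_∷_; [])
open import Data.Product using (Σ; ∃; _×_; _,_)
open import Data.Sum using (_⊎_; inj₁; inj₂; [_,_]′)
open import Data.Empty using (⊥-elim)
open import Function.Base using (_∘_)
open import Relation.Binary.PropositionalEquality
open import Relation.Nullary using (¬_)

module Parity where
  open import Data.Integer using (_+_; _*_; _-_)
  open import Data.Integer.DivMod using (_%ℕ_; _/ℕ_; a≡a%ℕn+[a/ℕn]*n; n%ℕd<d)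
  open import Data.Integer.Tactic.RingSolver using (solve)
  open ≡-Reasoning

  Even Odd : ℤ → Set
  Even z = ∃ λ k → z ≡ + 2 * k
  Odd z = ∃ λ k → z ≡ 1ℤ + + 2 * k

  even⊎odd : ∀ z → Even z ⊎ Odd z
  even⊎odd z with z %ℕ 2 | a≡a%ℕn+[a/ℕn]*n z 2 | n%ℕd<d z 2
  ... | 0 | eq | _ = inj₁ (z /ℕ 2 , trans eq (trans (ℤP.+-identityˡ _) (ℤP.*-comm _ (+ 2))))
  ... | 1 | eq | _ = inj₂ (z /ℕ 2 , trans eq (cong (λ x → 1ℤ + x) (ℤP.*-comm (z /ℕ 2) (+ 2))))
  ... | suc (suc _) | _ | ℕ.s≤s (ℕ.s≤s ())

  odd⇒¬even : ∀ {z} → Odd z → ¬ Even z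
  odd⇒¬even (k , refl) (m , eq) = ℕP.even≢odd ∣ m - k ∣ 0 (sym (begin
    1                   ≡⟨⟩
    ∣ 1ℤ ∣              ≡⟨ cong ∣_∣ one≡2[m-k] ⟩
    ∣ + 2 * (m - k) ∣   ≡⟨ ℤP.abs-* (+ 2) (m - k) ⟩
    2 ℕ.* ∣ m - k ∣ ∎))
    where
    one≡2[m-k] : 1ℤ ≡ + 2 * (m - k)
    one≡2[m-k] = begin
      1ℤ                          ≡⟨ solve (k ∷ []) ⟩
      (1ℤ + + 2 * k) - + 2 * k    ≡⟨ cong (_- + 2 * k) eq ⟩
      + 2 * m - + 2 * k           ≡⟨ solve (k ∷ m ∷ []) ⟩
      + 2 * (m - k)               ∎

  odd⇒≢0 : ∀ {z} → Odd z → z ≢ 0ℤ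
  odd⇒≢0 z-odd z≡0 = odd⇒¬even z-odd (0ℤ , z≡0)

  odd-* : ∀ {x y} → Odd x → Odd y → Odd (x * y)
  odd-* (k , refl) (m , refl) = k + m + + 2 * k * m , solve (k ∷ m ∷ [])

  even-*ʳ : ∀ {x} → Even x → ∀ y → Even (x * y)
  even-*ʳ (k , refl) y = k * y , ℤP.*-assoc (+ 2) k y

  even-*ˡ : ∀ x {y} → Even y → Even (x * y)
  even-*ˡ x (k , refl) = x * k , solve (x ∷ k ∷ [])

  odd-+-even : ∀ {x y} → Odd x → Even y → Odd (x + y)
  odd-+-even (k , refl) (m , refl) = k + m , solve (k ∷ m ∷ [])

  odd-−-even : ∀ {x y} → Odd x → Even y → Odd (x - y)
  odd-−-even (k , refl) (m , refl) = k - m , solve (k ∷ m ∷ [])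

  even-−-odd : ∀ {x y} → Even x → Odd y → Odd (x - y)
  even-−-odd (k , refl) (m , refl) = k - m - 1ℤ , solve (k ∷ m ∷ [])

  pronic-even : ∀ a → Even (a * a + a)
  pronic-even a = [ even-case , odd-case ]′ (even⊎odd a)
    where
    even-case : ∀ {a} → Even a → Even (a * a + a)
    even-case (k , refl) = + 2 * (k * k) + k , solve (k ∷ [])
    odd-case : ∀ {a} → Odd a → Even (a * a + a)
    odd-case (k , refl) = 1ℤ + + 3 * k + + 2 * (k * k) , solve (k ∷ [])

open Parity

module Points where
  open import Data.Integer using (_+_; _*_; _-_)
  open import Data.Integer.Tactic.RingSolver using (solve-∀)

  *-≢0 : ∀ {x y} → x ≢ 0ℤ → y ≢ 0ℤ → x * y ≢ 0ℤ
  *-≢0 {x} x≢0 y≢0 xy≡0 = [ x≢0 , y≢0 ]′ (ℤP.i*j≡0⇒i≡0∨j≡0 x xy≡0)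

  record Point (C v : ℤ) : Set where
    field
      B S T W : ℤ
      B-odd : Odd B
      T-odd : Odd T
      S≢0 : S ≢ 0ℤ
      W≢0 : W ≢ 0ℤ
      vW-even : Even (v * W)
      S-eq : S * S ≡ B + C * (W * W)
      T-eq : T * T ≡ B * B + C * (v * v) * ((W * W) * (W * W))

  doubleB doubleT : (C v W s t : ℤ) → ℤ
  doubleB C v W s t = t * t - + 4 * (C * (v * v) * (s * s) * ((W * W) * (W * W)))
  doubleT C v W s t = t * t + + 4 * (C * (v * v) * (s * s) * ((W * W) * (W * W)))

  doubleS : (v B W s : ℤ) → ℤ
  doubleS v B W s = B * B - B * ((v * W) * (v * W)) - + 2 * B * s + (v * W) * (v * W) * s

  doubleS-eq : ∀ B C v W {s t} → s ≡ B + C * (W * W) → t ≡ B * B + C * (v * v) * ((W * W) * (W * W)) →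
    doubleS v B W s * doubleS v B W s ≡ doubleB C v W s t + C * (+ 4 * s * t * (W * W))
  doubleS-eq B C v W refl refl = identity B C v W
    where
    -- The formulas are spelled out because the ring solver does not unfold definitions.
    identity : ∀ B C v W →
      let s = B + C * (W * W)
          t = B * B + C * (v * v) * ((W * W) * (W * W))
          S₂ = B * B - B * ((v * W) * (v * W)) - + 2 * B * s + (v * W) * (v * W) * s
      in S₂ * S₂ ≡ (t * t - + 4 * (C * (v * v) * (s * s) * ((W * W) * (W * W)))) + C * (+ 4 * s * t * (W * W))
    identity = solve-∀

  doubleT-eq : ∀ B C v W {s t} → s ≡ B + C * (W * W) → t ≡ B * B + C * (v * v) * ((W * W) * (W * W)) →
    doubleT C v W s t * doubleT C v W s t ≡
    doubleB C v W s t * doubleB C v W s t + C * (v * v) * ((+ 4 * s * t * (W * W)) * (+ 4 * s * t * (W * W)))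
  doubleT-eq B C v W refl refl = identity B C v W
    where
    identity : ∀ B C v W →
      let s = B + C * (W * W)
          t = B * B + C * (v * v) * ((W * W) * (W * W))
          B₂ = t * t - + 4 * (C * (v * v) * (s * s) * ((W * W) * (W * W)))
          T₂ = t * t + + 4 * (C * (v * v) * (s * s) * ((W * W) * (W * W)))
          W₂² = + 4 * s * t * (W * W)
      in T₂ * T₂ ≡ B₂ * B₂ + C * (v * v) * (W₂² * W₂²)
    identity = solve-∀

  2STW-square : ∀ S T W → (+ 2 * S * T * W) * (+ 2 * S * T * W) ≡ + 4 * (S * S) * (T * T) * (W * W)
  2STW-square = solve-∀

  double : ∀ {C v} → Point C v → Point C v
  double {C} {v} P = record
    { B = B₂
    ; S = doubleS v B W s
    ; T = doubleT C v W s t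
    ; W = + 2 * S * T * W
    ; B-odd = odd-−-even (odd-* t-odd t-odd) (even-*ʳ (+ 2 , refl) _)
    ; T-odd = odd-+-even (odd-* t-odd t-odd) (even-*ʳ (+ 2 , refl) _)
    ; S≢0 = odd⇒≢0 (odd-+-even (odd-−-even (odd-−-even (odd-* B-odd B-odd)
              (even-*ˡ B E²-even)) (even-*ʳ (B , refl) s)) (even-*ʳ E²-even s))
    ; W≢0 = *-≢0 (*-≢0 (*-≢0 {+ 2} (λ ()) S≢0) (odd⇒≢0 T-odd)) W≢0
    ; vW-even = even-*ˡ v (even-*ʳ (even-*ʳ (S , refl) T) W)
    ; S-eq = trans (doubleS-eq B C v W S-eq T-eq) (cong (λ x → B₂ + C * x) (sym (2STW-square S T W)))
    ; T-eq = trans (doubleT-eq B C v W S-eq T-eq) (cong (λ x → B₂ * B₂ + C * (v * v) * (x * x)) (sym (2STW-square S T W)))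
    }
    where
    open Point P
    s t B₂ : ℤ
    s = S * S
    t = T * T
    B₂ = doubleB C v W s t
    t-odd : Odd t
    t-odd = odd-* T-odd T-odd
    E²-even : Even ((v * W) * (v * W))
    E²-even = even-*ʳ vW-even (v * W)

open Points

module Iteration where
  open import Data.Integer using (_*_)
  open import Data.Integer.Tactic.RingSolver using (solve-∀)

  module _ {C v : ℤ} where
    2W∣W-double : (P : Point C v) → (+ 2 * Point.W P) ∣ Point.W (double P)
    2W∣W-double P = divides (S * T) (regroup S T W)
      where
      open Point P
      regroup : ∀ S T W → + 2 * S * T * W ≡ (S * T) * (+ 2 * W)
      regroup = solve-∀

    2W∣W-iterate : ∀ P k → (+ 2 * Point.W P) ∣ Point.W (fold P double (suc k))
    2W∣W-iterate P zero = 2W∣W-double P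
    2W∣W-iterate P (suc k) =
      ∣-trans (2W∣W-iterate P k) (∣-trans (divides (+ 2) refl) (2W∣W-double (fold P double (suc k))))

  same-ratio⇒even : ∀ B₁ B₂ v W {W′} → (+ 2 * W) ∣ W′ → v * W ≢ 0ℤ →
    B₂ * ((v * W) * (v * W)) ≡ B₁ * ((v * W′) * (v * W′)) → Even B₂
  same-ratio⇒even B₁ B₂ v W (divides K refl) vW≢0 eq =
    + 2 * B₁ * (K * K) ,
    ℤP.*-cancelʳ-≡ B₂ _ ((v * W) * (v * W)) {{ℤ.≢-nonZero (*-≢0 vW≢0 vW≢0)}} (trans eq (regroup B₁ v W K))
    where
    regroup : ∀ B v W K → B * ((v * (K * (+ 2 * W))) * (v * (K * (+ 2 * W)))) ≡
      + 2 * (+ 2 * B * (K * K)) * ((v * W) * (v * W))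
    regroup = solve-∀

open Iteration

module StartingPoints where
  open import Data.Integer using (_+_; _*_; _-_; -_)
  open import Data.Integer.Tactic.RingSolver using (solve-∀)
  open ≡-Reasoning

  -- This point and the next one both represent b = 5/4 - r².
  point-v-odd : ∀ u {v} → Odd v → Point (u * u - v * v) v
  point-v-odd u {v} v-odd = record
    { B = + 5 * (v * v) - + 4 * (u * u)
    ; S = v
    ; T = + 3 * (v * v) - + 4 * (u * u)
    ; W = + 2
    ; B-odd = odd-−-even (odd-* (+ 2 , refl) v²-odd) (even-*ʳ (+ 2 , refl) (u * u))
    ; T-odd = odd-−-even (odd-* (+ 1 , refl) v²-odd) (even-*ʳ (+ 2 , refl) (u * u))
    ; S≢0 = odd⇒≢0 v-odd
    ; W≢0 = λ ()
    ; vW-even = even-*ˡ v (1ℤ , refl)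
    ; S-eq = S-identity u v
    ; T-eq = T-identity u v
    }
    where
    v²-odd : Odd (v * v)
    v²-odd = odd-* v-odd v-odd
    S-identity : ∀ u v → v * v ≡ (+ 5 * (v * v) - + 4 * (u * u)) + (u * u - v * v) * (+ 2 * + 2)
    S-identity = solve-∀
    T-identity : ∀ u v → (+ 3 * (v * v) - + 4 * (u * u)) * (+ 3 * (v * v) - + 4 * (u * u)) ≡
      (+ 5 * (v * v) - + 4 * (u * u)) * (+ 5 * (v * v) - + 4 * (u * u)) + (u * u - v * v) * (v * v) * ((+ 2 * + 2) * (+ 2 * + 2))
    T-identity = solve-∀

  point-4∣v : ∀ {u} w → Odd u → w ≢ 0ℤ → let v = + 2 * (+ 2 * w) in Point (u * u - v * v) v
  point-4∣v {u} w u-odd w≢0 = record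
    { B = + 5 * (S * S) - u * u
    ; S = S
    ; T = + 3 * (S * S) - u * u
    ; W = 1ℤ
    ; B-odd = even-−-odd (even-*ˡ (+ 5) S²-even) u²-odd
    ; T-odd = even-−-odd (even-*ˡ (+ 3) S²-even) u²-odd
    ; S≢0 = *-≢0 {+ 2} (λ ()) w≢0
    ; vW-even = even-*ʳ (+ 2 * w , refl) 1ℤ
    ; W≢0 = λ ()
    ; S-eq = S-identity u w
    ; T-eq = T-identity u w
    }
    where
    S : ℤ
    S = + 2 * w
    S²-even : Even (S * S)
    S²-even = even-*ʳ (w , refl) S
    u²-odd : Odd (u * u)
    u²-odd = odd-* u-odd u-odd
    S-identity : ∀ u w → let S = + 2 * w ; v = + 2 * (+ 2 * w) in
      S * S ≡ (+ 5 * (S * S) - u * u) + (u * u - v * v) * (1ℤ * 1ℤ)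
    S-identity = solve-∀
    T-identity : ∀ u w → let S = + 2 * w ; v = + 2 * (+ 2 * w) in
      (+ 3 * (S * S) - u * u) * (+ 3 * (S * S) - u * u) ≡
      (+ 5 * (S * S) - u * u) * (+ 5 * (S * S) - u * u) + (u * u - v * v) * (v * v) * ((1ℤ * 1ℤ) * (1ℤ * 1ℤ))
    T-identity = solve-∀

  -- The point b = (1 + 16 r² - 16 r⁴) / (4 r² - 1)², written with u² = 1 + 4 p and
  -- (v / 2)² = 1 + 4 q.
  point-v≡2mod4 : ∀ a d →
    let p = a * a + a ; q = d * d + d ; u = 1ℤ + + 2 * a ; v = + 2 * (1ℤ + + 2 * d) in
    p - q ≢ 0ℤ → Point (u * u - v * v) v
  point-v≡2mod4 a d W≢0 = record
    { B = (1ℤ + + 4 * q) * F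
    ; S = u * X
    ; T = u * v₀ * Y
    ; W = p - q
    ; B-odd = odd-* (odd-+-even (0ℤ , refl) (even-*ʳ (+ 2 , refl) q)) (f , refl)
    ; T-odd = odd-* (odd-* u-odd v₀-odd) (even-−-odd (y , refl) (0ℤ , refl))
    ; S≢0 = odd⇒≢0 (odd-* u-odd (even-−-odd (pronic-even a)
              (odd-+-even (0ℤ , refl) (even-*ˡ (+ 5) (pronic-even d)))))
    ; W≢0 = W≢0
    ; vW-even = even-*ʳ (v₀ , refl) (p - q)
    ; S-eq = begin
        (u * X) * (u * X)                                         ≡⟨ square-* u X ⟩
        (u * u) * (X * X)                                         ≡⟨ cong (_* (X * X)) (odd-square a) ⟩
        (1ℤ + + 4 * p) * (X * X)                                  ≡⟨ S-identity p q ⟩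
        (1ℤ + + 4 * q) * F + C′ * ((p - q) * (p - q))             ≡⟨ cong (λ c → (1ℤ + + 4 * q) * F + c * ((p - q) * (p - q))) C≡C′ ⟨
        (1ℤ + + 4 * q) * F + (u * u - v * v) * ((p - q) * (p - q)) ∎
    ; T-eq = begin
        (u * v₀ * Y) * (u * v₀ * Y)                                ≡⟨ square-** u v₀ Y ⟩
        (u * u) * (v₀ * v₀) * (Y * Y)                              ≡⟨ cong₂ (λ x y → x * y * (Y * Y)) (odd-square a) (odd-square d) ⟩
        (1ℤ + + 4 * p) * (1ℤ + + 4 * q) * (Y * Y)                  ≡⟨ T-identity p q ⟩
        B₀ * B₀ + C′ * (+ 4 * (1ℤ + + 4 * q)) * W⁴                 ≡⟨ cong₂ (λ c w → B₀ * B₀ + c * w * W⁴) C≡C′ (v-square d) ⟨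
        B₀ * B₀ + (u * u - v * v) * (v * v) * W⁴                   ∎
    }
    where
    p q u v₀ v X y Y f F C′ B₀ W⁴ : ℤ
    p = a * a + a
    q = d * d + d
    u = 1ℤ + + 2 * a
    v₀ = 1ℤ + + 2 * d
    v = + 2 * v₀
    X = p - (1ℤ + + 5 * q)
    y = p * p - + 2 * p * q - + 7 * q * q - + 4 * q
    Y = + 2 * y - 1ℤ
    f = p + + 3 * q + + 2 * (q * q - p * p) + + 8 * p * q
    F = 1ℤ + + 2 * f
    C′ = (1ℤ + + 4 * p) - + 4 * (1ℤ + + 4 * q)
    B₀ = (1ℤ + + 4 * q) * F
    W⁴ = (p - q) * (p - q) * ((p - q) * (p - q))
    u-odd : Odd u
    u-odd = a , refl
    v₀-odd : Odd v₀
    v₀-odd = d , refl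
    square-* : ∀ x y → (x * y) * (x * y) ≡ (x * x) * (y * y)
    square-* = solve-∀
    square-** : ∀ x y z → (x * y * z) * (x * y * z) ≡ (x * x) * (y * y) * (z * z)
    square-** = solve-∀
    odd-square : ∀ a → (1ℤ + + 2 * a) * (1ℤ + + 2 * a) ≡ 1ℤ + + 4 * (a * a + a)
    odd-square = solve-∀
    v-square : ∀ d → (+ 2 * (1ℤ + + 2 * d)) * (+ 2 * (1ℤ + + 2 * d)) ≡ + 4 * (1ℤ + + 4 * (d * d + d))
    v-square = solve-∀
    C≡C′ : u * u - v * v ≡ C′
    C≡C′ = cong₂ (λ x y → x - y) (odd-square a) (v-square d)
    S-identity : ∀ p q →
      let X = p - (1ℤ + + 5 * q)
          F = 1ℤ + + 2 * (p + + 3 * q + + 2 * (q * q - p * p) + + 8 * p * q) in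
      (1ℤ + + 4 * p) * (X * X) ≡ (1ℤ + + 4 * q) * F + ((1ℤ + + 4 * p) - + 4 * (1ℤ + + 4 * q)) * ((p - q) * (p - q))
    S-identity = solve-∀
    T-identity : ∀ p q →
      let Y = + 2 * (p * p - + 2 * p * q - + 7 * q * q - + 4 * q) - 1ℤ
          B = (1ℤ + + 4 * q) * (1ℤ + + 2 * (p + + 3 * q + + 2 * (q * q - p * p) + + 8 * p * q)) in
      (1ℤ + + 4 * p) * (1ℤ + + 4 * q) * (Y * Y) ≡
      B * B + ((1ℤ + + 4 * p) - + 4 * (1ℤ + + 4 * q)) * (+ 4 * (1ℤ + + 4 * q)) * ((p - q) * (p - q) * ((p - q) * (p - q)))
    T-identity = solve-∀

  pronic-difference≢0 : ∀ a d → let u = 1ℤ + + 2 * a ; v = + 2 * (1ℤ + + 2 * d) in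
    v ≢ + 2 * u → v ≢ + 2 * (- u) → (a * a + a) - (d * d + d) ≢ 0ℤ
  pronic-difference≢0 a d v≢2u v≢-2u p-q≡0 =
    [ a-d≢0 , a+d+1≢0 ]′ (ℤP.i*j≡0⇒i≡0∨j≡0 (a - d) (trans (sym (factor a d)) p-q≡0))
    where
    factor : ∀ a d → (a * a + a) - (d * d + d) ≡ (a - d) * (a + d + 1ℤ)
    factor = solve-∀
    twice : ∀ a d → (1ℤ + + 2 * d) - - (1ℤ + + 2 * a) ≡ + 2 * (a + d + 1ℤ)
    twice = solve-∀
    a-d≢0 : a - d ≢ 0ℤ
    a-d≢0 a-d≡0 = v≢2u (cong (λ x → + 2 * (1ℤ + + 2 * x)) (sym (ℤP.i-j≡0⇒i≡j a d a-d≡0)))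
    a+d+1≢0 : a + d + 1ℤ ≢ 0ℤ
    a+d+1≢0 a+d+1≡0 = v≢-2u (cong (+ 2 *_) (ℤP.i-j≡0⇒i≡j _ _ (begin
      (1ℤ + + 2 * d) - - (1ℤ + + 2 * a)  ≡⟨ twice a d ⟩
      + 2 * (a + d + 1ℤ)                 ≡⟨ cong (+ 2 *_) a+d+1≡0 ⟩
      0ℤ                                 ∎)))

  starting-point : ∀ u v → ¬ (Even u × Even v) → v ≢ 0ℤ → v ≢ + 2 * u → v ≢ + 2 * (- u) →
    Point (u * u - v * v) v
  starting-point u v not-both-even v≢0 v≢2u v≢-2u with even⊎odd v
  ... | inj₂ v-odd = point-v-odd u v-odd
  ... | inj₁ (m , refl) with even⊎odd u | even⊎odd m
  ...   | inj₁ u-even | _ = ⊥-elim (not-both-even (u-even , (m , refl)))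
  ...   | inj₂ u-odd | inj₁ (w , refl) =
    point-4∣v w u-odd (λ w≡0 → v≢0 (cong (λ x → + 2 * (+ 2 * x)) w≡0))
  ...   | inj₂ (a , refl) | inj₂ (d , refl) = point-v≡2mod4 a d (pronic-difference≢0 a d v≢2u v≢-2u)

open StartingPoints

open import Defs
open import Level using (0ℓ)
open import Relation.Nullary.Decidable using (dec⇒maybe)
open import Relation.Binary.Definitions using (tri<; tri≈; tri>)
open import Function.Definitions using (Injective)
open import Data.Nat.Divisibility using (divides) renaming (_∣_ to _∣ℕ_)
import Data.Nat.Coprimality as Coprime
import Data.Integer.Tactic.RingSolver as ℤ-Solver
open import Data.Rational using (ℚ; mkℚ; ↥_; ↧_; _+_; _*_; _-_; -_; 1/_; 0ℚ; 1ℚ; ½)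
import Data.Rational as ℚ
import Data.Rational.Properties as ℚP
import Data.Rational.Unnormalised as ℚᵘ
import Data.Rational.Unnormalised.Properties as ℚᵘP
open import Tactic.RingSolver using (solve)
open import Tactic.RingSolver.Core.AlmostCommutativeRing using (AlmostCommutativeRing; fromCommutativeRing)
open ≡-Reasoning

module _ {A : Set} (f : ℕ → A) (later-differs : ∀ m o → f (suc o ℕ.+ m) ≢ f m) where
  <⇒≢ : ∀ {m n} → m ℕ.< n → f n ≢ f m
  <⇒≢ {m} m<n with ℕP.m≤n⇒∃[o]m+o≡n m<n
  ... | o , refl = later-differs m o ∘ trans (cong (f ∘ suc) (ℕP.+-comm o m))

  injective-if-later-differ : Injective _≡_ _≡_ f
  injective-if-later-differ {m} {n} fm≡fn with ℕP.<-cmp m n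
  ... | tri< m<n _ _ = ⊥-elim (<⇒≢ m<n (sym fm≡fn))
  ... | tri≈ _ m≡n _ = m≡n
  ... | tri> _ _ n<m = ⊥-elim (<⇒≢ n<m fm≡fn)

-- The zero test lets the solver cancel constant terms such as 1 - 1.
ℚ-ring : AlmostCommutativeRing 0ℓ 0ℓ
ℚ-ring = fromCommutativeRing ℚP.+-*-commutativeRing (λ x → dec⇒maybe (0ℚ ℚP.≟ x))

*-cancelʳ-invertible : ∀ p q y j → y * j ≡ 1ℚ → p * y ≡ q * y → p ≡ q
*-cancelʳ-invertible p q y j yj≡1 py≡qy = begin
  p             ≡⟨ solve (p ∷ []) ℚ-ring ⟩
  p * 1ℚ        ≡⟨ cong (p *_) yj≡1 ⟨
  p * (y * j)   ≡⟨ ℚP.*-assoc p y j ⟨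
  (p * y) * j   ≡⟨ cong (_* j) py≡qy ⟩
  (q * y) * j   ≡⟨ ℚP.*-assoc q y j ⟩
  q * (y * j)   ≡⟨ cong (q *_) yj≡1 ⟩
  q * 1ℚ        ≡⟨ solve (q ∷ []) ℚ-ring ⟩
  q             ∎

cross-multiply : ∀ β₁ β₂ d₁ d₂ i₁ i₂ → d₁ * i₁ ≡ 1ℚ → d₂ * i₂ ≡ 1ℚ →
  β₁ * (i₁ * i₁) ≡ β₂ * (i₂ * i₂) → β₁ * (d₂ * d₂) ≡ β₂ * (d₁ * d₁)
cross-multiply β₁ β₂ d₁ d₂ i₁ i₂ d₁i₁≡1 d₂i₂≡1 eq = begin
  β₁ * (d₂ * d₂)                              ≡⟨ solve (β₁ ∷ d₂ ∷ []) ℚ-ring ⟩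
  β₁ * (d₂ * d₂) * (1ℚ * 1ℚ)                  ≡⟨ cong (λ x → β₁ * (d₂ * d₂) * (x * x)) d₁i₁≡1 ⟨
  β₁ * (d₂ * d₂) * ((d₁ * i₁) * (d₁ * i₁))    ≡⟨ solve (β₁ ∷ d₁ ∷ d₂ ∷ i₁ ∷ []) ℚ-ring ⟩
  β₁ * (i₁ * i₁) * ((d₁ * d₂) * (d₁ * d₂))    ≡⟨ cong (_* ((d₁ * d₂) * (d₁ * d₂))) eq ⟩
  β₂ * (i₂ * i₂) * ((d₁ * d₂) * (d₁ * d₂))    ≡⟨ solve (β₂ ∷ d₁ ∷ d₂ ∷ i₂ ∷ []) ℚ-ring ⟩
  β₂ * (d₁ * d₁) * ((d₂ * i₂) * (d₂ * i₂))    ≡⟨ cong (λ x → β₂ * (d₁ * d₁) * (x * x)) d₂i₂≡1 ⟩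
  β₂ * (d₁ * d₁) * (1ℚ * 1ℚ)                  ≡⟨ solve (β₂ ∷ d₁ ∷ []) ℚ-ring ⟩
  β₂ * (d₁ * d₁)                              ∎

r²-1≡[u²-v²][Wi]² : ∀ r {u} v W i → r * v ≡ u → v * W * i ≡ 1ℚ → r * r - 1ℚ ≡ (u * u - v * v) * ((W * i) * (W * i))
r²-1≡[u²-v²][Wi]² r v W i refl vWi≡1 = begin
  r * r - 1ℚ                                    ≡⟨ solve (r ∷ []) ℚ-ring ⟩
  (r * r - 1ℚ) * (1ℚ * 1ℚ)                      ≡⟨ cong (λ x → (r * r - 1ℚ) * (x * x)) vWi≡1 ⟨
  (r * r - 1ℚ) * ((v * W * i) * (v * W * i))    ≡⟨ solve (r ∷ v ∷ W ∷ i ∷ []) ℚ-ring ⟩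
  ((r * v) * (r * v) - v * v) * ((W * i) * (W * i)) ∎

b+q-square : ∀ B C S W i {q} → S * S ≡ B + C * (W * W) → q ≡ C * ((W * i) * (W * i)) →
  (S * i) * (S * i) ≡ 1ℚ * (B * (i * i)) + q
b+q-square B C S W i S-eq refl = begin
  (S * i) * (S * i)                              ≡⟨ solve (S ∷ i ∷ []) ℚ-ring ⟩
  (S * S) * (i * i)                              ≡⟨ cong (_* (i * i)) S-eq ⟩
  (B + C * (W * W)) * (i * i)                    ≡⟨ solve (B ∷ C ∷ W ∷ i ∷ []) ℚ-ring ⟩
  1ℚ * (B * (i * i)) + C * ((W * i) * (W * i))   ∎

b²+q-square : ∀ B C T v W i {q} → T * T ≡ B * B + C * (v * v) * ((W * W) * (W * W)) → v * W * i ≡ 1ℚ →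
  q ≡ C * ((W * i) * (W * i)) → (T * (i * i)) * (T * (i * i)) ≡ (B * (i * i)) * (B * (i * i)) + q
b²+q-square B C T v W i T-eq vWi≡1 refl = begin
  (T * (i * i)) * (T * (i * i))
    ≡⟨ solve (T ∷ i ∷ []) ℚ-ring ⟩
  (T * T) * ((i * i) * (i * i))
    ≡⟨ cong (_* ((i * i) * (i * i))) T-eq ⟩
  (B * B + C * (v * v) * ((W * W) * (W * W))) * ((i * i) * (i * i))
    ≡⟨ solve (B ∷ C ∷ v ∷ W ∷ i ∷ []) ℚ-ring ⟩
  (B * (i * i)) * (B * (i * i)) + C * ((W * i) * (W * i)) * ((v * W * i) * (v * W * i))
    ≡⟨ cong (λ x → (B * (i * i)) * (B * (i * i)) + C * ((W * i) * (W * i)) * (x * x)) vWi≡1 ⟩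
  (B * (i * i)) * (B * (i * i)) + C * ((W * i) * (W * i)) * (1ℚ * 1ℚ)
    ≡⟨ solve (B ∷ C ∷ W ∷ i ∷ []) ℚ-ring ⟩
  (B * (i * i)) * (B * (i * i)) + C * ((W * i) * (W * i)) ∎

ι : ℤ → ℚ
ι z = mkℚ z 0 (Coprime.sym (Coprime.1-coprimeTo ℤ.∣ z ∣))

ι-injective : ∀ {a b} → ι a ≡ ι b → a ≡ b
ι-injective = cong ↥_

ι-+ : ∀ a b → ι (a ℤ.+ b) ≡ ι a + ι b
ι-+ a b = ℚP.toℚᵘ-injective (ℚᵘP.≃-trans (ℚᵘ.*≡* (cross a b)) (ℚᵘP.≃-sym (ℚP.toℚᵘ-homo-+ (ι a) (ι b))))
  where
  cross : ∀ a b → (a ℤ.+ b) ℤ.* (1ℤ ℤ.* 1ℤ) ≡ (a ℤ.* 1ℤ ℤ.+ b ℤ.* 1ℤ) ℤ.* 1ℤ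
  cross = ℤ-Solver.solve-∀

ι-* : ∀ a b → ι (a ℤ.* b) ≡ ι a * ι b
ι-* a b = ℚP.toℚᵘ-injective (ℚᵘP.≃-trans (ℚᵘ.*≡* (cross a b)) (ℚᵘP.≃-sym (ℚP.toℚᵘ-homo-* (ι a) (ι b))))
  where
  cross : ∀ a b → (a ℤ.* b) ℤ.* (1ℤ ℤ.* 1ℤ) ≡ (a ℤ.* b) ℤ.* 1ℤ
  cross = ℤ-Solver.solve-∀

ι-neg : ∀ a → ι (ℤ.- a) ≡ - ι a
ι-neg (+ zero) = refl
ι-neg (+ suc n) = refl
ι-neg -[1+ n ] = refl

ι-- : ∀ a b → ι (a ℤ.- b) ≡ ι a - ι b
ι-- a b = trans (ι-+ a (ℤ.- b)) (cong (λ x → ι a + x) (ι-neg b))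

ι-S-eq : ∀ B C S W → S ℤ.* S ≡ B ℤ.+ C ℤ.* (W ℤ.* W) → ι S * ι S ≡ ι B + ι C * (ι W * ι W)
ι-S-eq B C S W eq = begin
  ι S * ι S                    ≡⟨ ι-* S S ⟨
  ι (S ℤ.* S)                  ≡⟨ cong ι eq ⟩
  ι (B ℤ.+ C ℤ.* (W ℤ.* W))    ≡⟨ ι-+ B _ ⟩
  ι B + ι (C ℤ.* (W ℤ.* W))    ≡⟨ cong (λ x → ι B + x) (trans (ι-* C _) (cong (ι C *_) (ι-* W W))) ⟩
  ι B + ι C * (ι W * ι W)      ∎

ι-T-eq : ∀ B C T v W → T ℤ.* T ≡ B ℤ.* B ℤ.+ C ℤ.* (v ℤ.* v) ℤ.* ((W ℤ.* W) ℤ.* (W ℤ.* W)) →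
  ι T * ι T ≡ ι B * ι B + ι C * (ι v * ι v) * ((ι W * ι W) * (ι W * ι W))
ι-T-eq B C T v W eq = begin
  ι T * ι T
    ≡⟨ ι-* T T ⟨
  ι (T ℤ.* T)
    ≡⟨ cong ι eq ⟩
  ι (B ℤ.* B ℤ.+ C ℤ.* (v ℤ.* v) ℤ.* ((W ℤ.* W) ℤ.* (W ℤ.* W)))
    ≡⟨ ι-+ (B ℤ.* B) _ ⟩
  ι (B ℤ.* B) + ι (C ℤ.* (v ℤ.* v) ℤ.* ((W ℤ.* W) ℤ.* (W ℤ.* W)))
    ≡⟨ cong₂ _+_ (ι-* B B) (trans (ι-* (C ℤ.* (v ℤ.* v)) _) (cong₂ _*_
         (trans (ι-* C (v ℤ.* v)) (cong (ι C *_) (ι-* v v)))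
         (trans (ι-* (W ℤ.* W) (W ℤ.* W)) (cong₂ _*_ (ι-* W W) (ι-* W W))))) ⟩
  ι B * ι B + ι C * (ι v * ι v) * ((ι W * ι W) * (ι W * ι W)) ∎

*-denominator≡numerator : ∀ r → r * ι (↧ r) ≡ ι (↥ r)
*-denominator≡numerator r@(mkℚ n d _) = ℚP.toℚᵘ-injective
  (ℚᵘP.≃-trans (ℚP.toℚᵘ-homo-* r (ι (↧ r))) (ℚᵘ.*≡* (ℤP.*-assoc n (+ suc d) 1ℤ)))

ι⁻¹ : (d : ℤ) → d ≢ 0ℤ → ℚ
ι⁻¹ d d≢0 = (1/ ι d) {{ℚ.≢-nonZero (d≢0 ∘ ι-injective)}}

ι-inverse : ∀ d (d≢0 : d ≢ 0ℤ) → ι d * ι⁻¹ d d≢0 ≡ 1ℚ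
ι-inverse d d≢0 = ℚP.*-inverseʳ (ι d) {{ℚ.≢-nonZero (d≢0 ∘ ι-injective)}}

n/d² : (n d : ℤ) → d ≢ 0ℤ → ℚ
n/d² n d d≢0 = ι n * (ι⁻¹ d d≢0 * ι⁻¹ d d≢0)

n/d²-cross : ∀ {n₁ d₁ n₂ d₂} (d₁≢0 : d₁ ≢ 0ℤ) (d₂≢0 : d₂ ≢ 0ℤ) →
  n/d² n₁ d₁ d₁≢0 ≡ n/d² n₂ d₂ d₂≢0 → n₁ ℤ.* (d₂ ℤ.* d₂) ≡ n₂ ℤ.* (d₁ ℤ.* d₁)
n/d²-cross {n₁} {d₁} {n₂} {d₂} d₁≢0 d₂≢0 eq = ι-injective (begin
  ι (n₁ ℤ.* (d₂ ℤ.* d₂))    ≡⟨ ι-*² n₁ d₂ ⟩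
  ι n₁ * (ι d₂ * ι d₂)      ≡⟨ cross-multiply (ι n₁) (ι n₂) (ι d₁) (ι d₂) (ι⁻¹ d₁ d₁≢0) (ι⁻¹ d₂ d₂≢0)
                                   (ι-inverse d₁ d₁≢0) (ι-inverse d₂ d₂≢0) eq ⟩
  ι n₂ * (ι d₁ * ι d₁)      ≡⟨ ι-*² n₂ d₁ ⟨
  ι (n₂ ℤ.* (d₁ ℤ.* d₁))    ∎)
  where
  ι-*² : ∀ n d → ι (n ℤ.* (d ℤ.* d)) ≡ ι n * (ι d * ι d)
  ι-*² n d = trans (ι-* n (d ℤ.* d)) (cong (ι n *_) (ι-* d d))

n/d²≡0⇒n≡0 : ∀ {n d} (d≢0 : d ≢ 0ℤ) → n/d² n d d≢0 ≡ 0ℚ → n ≡ 0ℤ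
n/d²≡0⇒n≡0 {n} {d} d≢0 eq = begin
  n                 ≡⟨ ℤP.*-identityʳ n ⟨
  n ℤ.* 1ℤ          ≡⟨ n/d²-cross {n₂ = 0ℤ} {d₂ = 1ℤ} d≢0 (λ ()) eq ⟩
  0ℤ ℤ.* (d ℤ.* d)  ≡⟨ ℤP.*-zeroˡ (d ℤ.* d) ⟩
  0ℤ                ∎

1≡n/d²⇒d²≡n : ∀ {n d} (d≢0 : d ≢ 0ℤ) → 1ℚ ≡ n/d² n d d≢0 → d ℤ.* d ≡ n
1≡n/d²⇒d²≡n {n} {d} d≢0 eq = begin
  d ℤ.* d            ≡⟨ ℤP.*-identityˡ (d ℤ.* d) ⟨
  1ℤ ℤ.* (d ℤ.* d)   ≡⟨ n/d²-cross {1ℤ} {1ℤ} (λ ()) d≢0 eq ⟩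
  n ℤ.* 1ℤ           ≡⟨ ℤP.*-identityʳ n ⟩
  n                  ∎

r≡½ : ∀ {r u v} → r * ι v ≡ ι u → v ≢ 0ℤ → v ≡ + 2 ℤ.* u → r ≡ ½
r≡½ {r} {u} r*v≡u v≢0 refl = *-cancelʳ-invertible r ½ (ι (+ 2)) ½ refl
  (*-cancelʳ-invertible (r * ι (+ 2)) 1ℚ (ι u) (ι⁻¹ u u≢0) (ι-inverse u u≢0) (begin
    r * ι (+ 2) * ι u      ≡⟨ ℚP.*-assoc r (ι (+ 2)) (ι u) ⟩
    r * (ι (+ 2) * ι u)    ≡⟨ cong (r *_) (ι-* (+ 2) u) ⟨
    r * ι (+ 2 ℤ.* u)      ≡⟨ r*v≡u ⟩
    ι u                    ≡⟨ ℚP.*-identityˡ (ι u) ⟨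
    1ℚ * ι u               ∎))
  where
  u≢0 : u ≢ 0ℤ
  u≢0 u≡0 = v≢0 (cong (+ 2 ℤ.*_) u≡0)

r≡-½ : ∀ {r u v} → r * ι v ≡ ι u → v ≢ 0ℤ → v ≡ + 2 ℤ.* (ℤ.- u) → r ≡ - ½
r≡-½ {r} {u} {v} r*v≡u v≢0 v≡-2u = ℚP.neg-injective (r≡½ -r*v≡-u v≢0 v≡-2u)
  where
  -r*v≡-u : - r * ι v ≡ ι (ℤ.- u)
  -r*v≡-u = begin
    - r * ι v    ≡⟨ ℚP.neg-distribˡ-* r (ι v) ⟨
    - (r * ι v)  ≡⟨ cong -_ r*v≡u ⟩
    - ι u        ≡⟨ ι-neg u ⟨
    ι (ℤ.- u)    ∎

even⇒2∣∣z∣ : ∀ {z} → Even z → 2 ∣ℕ ℤ.∣ z ∣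
even⇒2∣∣z∣ (k , refl) = divides ℤ.∣ k ∣ (trans (ℤP.abs-* (+ 2) k) (ℕP.*-comm 2 ℤ.∣ k ∣))

lowest-terms-not-both-even : ∀ r → ¬ (Even (↥ r) × Even (↧ r))
lowest-terms-not-both-even (mkℚ _ _ coprime) (n-even , d-even) with
  Coprime.recompute coprime (even⇒2∣∣z∣ n-even , even⇒2∣∣z∣ d-even)
... | ()

module PairsFromPoints (r : ℚ) {u v : ℤ} (r*v≡u : r * ι v ≡ ι u) (v≢0 : v ≢ 0ℤ) where
  C : ℤ
  C = u ℤ.* u ℤ.- v ℤ.* v

  ι-C : ι C ≡ ι u * ι u - ι v * ι v
  ι-C = trans (ι-- (u ℤ.* u) (v ℤ.* v)) (cong₂ _-_ (ι-* u u) (ι-* v v))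

  vW≢0 : (P : Point C v) → v ℤ.* Point.W P ≢ 0ℤ
  vW≢0 P = *-≢0 v≢0 (Point.W≢0 P)

  value : Point C v → ℚ
  value P = n/d² (Point.B P) (v ℤ.* Point.W P) (vW≢0 P)

  value-strongPair : (P : Point C v) → StrongDPair (r * r - 1ℚ) 1ℚ (value P)
  value-strongPair P =
    1≢value , (λ ()) , value≢0 , (r , r²≡1+q) ,
    (ι T * (i * i) , b²+q-square (ι B) (ι C) (ι T) (ι v) (ι W) i (ι-T-eq B C T v W T-eq) vWi≡1 q≡) ,
    (ι S * i , b+q-square (ι B) (ι C) (ι S) (ι W) i (ι-S-eq B C S W S-eq) q≡)
    where
    open Point P
    r²≡1+q : r * r ≡ 1ℚ * 1ℚ + (r * r - 1ℚ)
    r²≡1+q = solve (r ∷ []) ℚ-ring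
    i : ℚ
    i = ι⁻¹ (v ℤ.* W) (vW≢0 P)
    vWi≡1 : ι v * ι W * i ≡ 1ℚ
    vWi≡1 = trans (cong (_* i) (sym (ι-* v W))) (ι-inverse (v ℤ.* W) (vW≢0 P))
    q≡ : r * r - 1ℚ ≡ ι C * ((ι W * i) * (ι W * i))
    q≡ = trans (r²-1≡[u²-v²][Wi]² r (ι v) (ι W) i r*v≡u vWi≡1) (cong (_* ((ι W * i) * (ι W * i))) (sym ι-C))
    value≢0 : ¬ value P ≡ 0ℚ
    value≢0 = odd⇒≢0 B-odd ∘ n/d²≡0⇒n≡0 (vW≢0 P)
    1≢value : ¬ 1ℚ ≡ value P
    1≢value eq = odd⇒¬even B-odd (subst Even (1≡n/d²⇒d²≡n (vW≢0 P) eq) (even-*ʳ vW-even (v ℤ.* W)))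

  value-iterate≢ : ∀ P o → value (fold P double (suc o)) ≢ value P
  value-iterate≢ P o eq = odd⇒¬even (B-odd Q)
    (same-ratio⇒even (B P) (B Q) v (W P) (2W∣W-iterate P o) (vW≢0 P) (n/d²-cross {B Q} {_} {B P} (vW≢0 Q) (vW≢0 P) eq))
    where
    open Point
    Q : Point C v
    Q = fold P double (suc o)

  strong-pairs : Point C v → Σ (ℕ → ℚ) λ b → Injective _≡_ _≡_ b × ((n : ℕ) → StrongDPair (r * r - 1ℚ) 1ℚ (b n))
  strong-pairs P = b , injective-if-later-differ b later-differs , λ n → value-strongPair (fold P double n)
    where
    b : ℕ → ℚ
    b n = value (fold P double n)
    later-differs : ∀ m o → b (suc o ℕ.+ m) ≢ b m
    later-differs m o = value-iterate≢ (fold P double m) o ∘ trans (cong value (sym (fold-+ P double (suc o))))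

proposition2 : (r : ℚ) → ¬ (r ≡ 0ℚ) → ¬ (r ≡ 1ℚ) → ¬ (r ≡ - 1ℚ) → ¬ (r ≡ ½) → ¬ (r ≡ - ½) →
    Σ (ℕ → ℚ) λ b → Injective _≡_ _≡_ b × ((n : ℕ) → StrongDPair (r * r - 1ℚ) 1ℚ (b n))
proposition2 r _ _ _ r≢½ r≢-½ = PairsFromPoints.strong-pairs r r*v≡u v≢0
  (starting-point (↥ r) (↧ r) (lowest-terms-not-both-even r) v≢0
    (r≢½ ∘ r≡½ r*v≡u v≢0) (r≢-½ ∘ r≡-½ r*v≡u v≢0))
  where
  r*v≡u : r * ι (↧ r) ≡ ι (↥ r)
  r*v≡u = *-denominator≡numerator r
  v≢0 : ↧ r ≢ 0ℤ
  v≢0 ()
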